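{- Let $G$ be a connected, well-edge-dominated bipartite graph with bipartition $V(G)=A\cup B$ where $|A|\le|B|$. Let $x$ be a cut-vertex of $G$ and let $H_1,\dots,H_k$ be the components of $G-x$. Then: 1. If $x\in A$, then for every $i\in[k]$ there exists a maximal matching of $G_i$, the subgraph induced by $V(H_i)\cup\{x\}$, which saturates the partite set of $G_i$ containing $x$. 2. If $x\in B$, then for any collection $H_{\alpha_1},\dots,H_{\alpha_j}$ of components of $G-x$ with $j<k$, there exist two maximal matchings $M_1$ and $M_2$ of the same size in the subgraph induced by $V(G)-\bigcup_{i=1}^j V(H_{\alpha_i})$ such that $M_1$ saturates $x$ and $M_2$ does not saturate $x$.
   Context: All graphs are simple and finite. A set $F$ of edges of $G$ is an edge dominating set if every edge of $G$ is in $F$ or shares an endpoint with an edge of $F$. $G$ is well-edge-dominated if all minimal (with respect to inclusion) edge dominating sets of $G$ have the same cardinality. A matching saturates a vertex if the vertex is incident to an edge of the matching, and saturates a set if it saturates each of its vertices. A cut-vertex of a connected graph $G$ is a vertex $x$ such that $G-x$ is disconnected. $[k]=\{1,\dots,k\}$. -}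

module Defs where

open import Data.Nat using (ℕ; zero; suc; _+_; _<ᵇ_)
open import Data.Bool using (Bool; true; false; _∧_; _∨_; not; if_then_else_)
open import Data.Fin using (Fin; toℕ; _≟_)
open import Data.List using (List; map; allFin)
open import Data.Nat.ListAction using (sum)
open import Data.Bool.ListAction using (any)
open import Data.Product using (Σ; _×_; _,_)
open import Data.Sum using (_⊎_)
open import Relation.Nullary using (¬_)
open import Relation.Nullary.Decidable using (⌊_⌋)
open import Relation.Binary.PropositionalEquality using (_≡_; _≢_; refl)

record Graph (n : ℕ) : Set where
  field
    adj        : Fin n → Fin n → Bool
    adj-sym    : ∀ u v → adj u v ≡ adj v u
    adj-irrefl : ∀ v → adj v v ≡ false
open Graph public

-- Vertex sets and edge sets (an edge set is a symmetric Boolean relation;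
-- the unordered edge {u,v} is in F iff F u v ≡ true).
VSet : ℕ → Set
VSet n = Fin n → Bool

EdgeSet : ℕ → Set
EdgeSet n = Fin n → Fin n → Bool

∣_∣V : ∀ {n} → VSet n → ℕ
∣_∣V {n} S = sum (map (λ v → if S v then 1 else 0) (allFin n))

∣_∣E : ∀ {n} → EdgeSet n → ℕ
∣_∣E {n} F = sum (map (λ u → sum (map (λ v → if (toℕ u <ᵇ toℕ v) ∧ F u v then 1 else 0) (allFin n))) (allFin n))

IsEdgeSubset : ∀ {n} → Graph n → EdgeSet n → Set
IsEdgeSubset G F = (∀ u v → F u v ≡ F v u) × (∀ u v → F u v ≡ true → adj G u v ≡ true)

_⊆E_ : ∀ {n} → EdgeSet n → EdgeSet n → Set
F ⊆E F' = ∀ u v → F u v ≡ true → F' u v ≡ true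

Dominates : ∀ {n} → Graph n → EdgeSet n → Set
Dominates {n} G F = ∀ u v → adj G u v ≡ true →
  F u v ≡ true ⊎ Σ (Fin n) (λ w → F u w ≡ true ⊎ F v w ≡ true)

IsEDS : ∀ {n} → Graph n → EdgeSet n → Set
IsEDS G F = IsEdgeSubset G F × Dominates G F

IsMinimalEDS : ∀ {n} → Graph n → EdgeSet n → Set
IsMinimalEDS G F = IsEDS G F × (∀ F' → IsEDS G F' → F' ⊆E F → F ⊆E F')

WellEdgeDominated : ∀ {n} → Graph n → Set
WellEdgeDominated G = ∀ F F' → IsMinimalEDS G F → IsMinimalEDS G F' → ∣ F ∣E ≡ ∣ F' ∣E

IsMatching : ∀ {n} → Graph n → EdgeSet n → Set
IsMatching G M = IsEdgeSubset G M × (∀ u v w → M u v ≡ true → M u w ≡ true → v ≡ w)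

IsMaximalMatching : ∀ {n} → Graph n → EdgeSet n → Set
IsMaximalMatching G M = IsMatching G M × (∀ M' → IsMatching G M' → M ⊆E M' → M' ⊆E M)

Saturates : ∀ {n} → EdgeSet n → Fin n → Set
Saturates {n} M v = Σ (Fin n) (λ w → M v w ≡ true)

-- Induced subgraph G[S], represented on the same vertex type Fin n:
-- edges are the edges of G with both ends in S; vertices outside S become
-- isolated (so they are never saturated by a matching).
private
  ind-sym : ∀ {n} (G : Graph n) (S : VSet n) (u v : Fin n) →
    S u ∧ (S v ∧ adj G u v) ≡ S v ∧ (S u ∧ adj G v u)
  ind-sym G S u v with S u | S v | adj G u v | adj-sym G u v
  ... | true  | true  | a | e = e
  ... | true  | false | a | e = refl
  ... | false | true  | a | e = refl
  ... | false | false | a | e = refl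

  ind-irrefl : ∀ {n} (G : Graph n) (S : VSet n) (v : Fin n) →
    S v ∧ (S v ∧ adj G v v) ≡ false
  ind-irrefl G S v with S v | adj G v v | adj-irrefl G v
  ... | true  | a | e = e
  ... | false | a | e = refl

Induced : ∀ {n} → Graph n → VSet n → Graph n
Induced G S = record
  { adj        = λ u v → S u ∧ (S v ∧ adj G u v)
  ; adj-sym    = ind-sym G S
  ; adj-irrefl = ind-irrefl G S
  }

Delete : ∀ {n} → Graph n → Fin n → Graph n
Delete G x = Induced G (λ v → not ⌊ v ≟ x ⌋)

data Reach {n} (G : Graph n) : Fin n → Fin n → Set where
  here : ∀ {u} → Reach G u u
  step : ∀ {u w v} → adj G u w ≡ true → Reach G w v → Reach G u v

Connected : ∀ {n} → Graph n → Set
Connected G = ∀ u v → Reach G u v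

IsCutVertex : ∀ {n} → Graph n → Fin n → Set
IsCutVertex {n} G x = Σ (Fin n) λ u → Σ (Fin n) λ v →
  u ≢ x × v ≢ x × ¬ Reach (Delete G x) u v

IsComponentOfDelete : ∀ {n} → Graph n → Fin n → VSet n → Set
IsComponentOfDelete {n} G x C =
  C x ≡ false ×
  Σ (Fin n) (λ c → C c ≡ true) ×
  (∀ u v → C u ≡ true → v ≢ x → (C v ≡ true → Reach (Delete G x) u v) × (Reach (Delete G x) u v → C v ≡ true))

AreComponentsOfDelete : ∀ {n} → Graph n → Fin n → (k : ℕ) → (Fin k → VSet n) → Set
AreComponentsOfDelete {n} G x k H =
  (∀ i → IsComponentOfDelete G x (H i)) ×
  (∀ i i' → (∀ v → H i v ≡ H i' v) → i ≡ i') ×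
  (∀ v → v ≢ x → Σ (Fin k) (λ i → H i v ≡ true))

-- side v ≡ true means v ∈ A, side v ≡ false means v ∈ B
IsBipartition : ∀ {n} → Graph n → VSet n → Set
IsBipartition G side = ∀ u v → adj G u v ≡ true → side u ≢ side v

_==_ : ∀ {n} → Fin n → Fin n → Bool
u == v = ⌊ u ≟ v ⌋

UnionOf : ∀ {n k j} → (Fin k → VSet n) → (Fin j → Fin k) → VSet n
UnionOf {j = j} H α v = any (λ i → H (α i) v) (allFin j)

-- Every maximal matching is a minimal edge dominating set, so in a well-edge-dominated
-- graph all maximal matchings have one size ν, which is then the matching number.
-- Exchanging matching edges along a walk shows that, G being connected, no matching of
-- size ν leaves an A-vertex and a B-vertex free at the same time. A maximal matching
-- missing a ∈ A thus saturates B and matches it injectively into A − a, contradicting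
-- |A| ≤ |B|.
--
-- For x ∈ A, restrict to V(H_i) ∪ {x} a maximal matching containing an edge xy with
-- y ∈ H_i. For x ∈ B, pick a component C = H_{i₀} that is not removed, a neighbour y of
-- x in C and a neighbour y′ of x in another component. Take maximal matchings M ∋ xy and
-- M′ ∋ xy′, and let M₂ agree with M′ inside C and with M outside C ∪ {x}. Then M₂
-- saturates A, hence is maximal and as large as M, and misses x. Both M and M₂ agree on
-- the removed components, so their restrictions to the remaining vertices are the two
-- required matchings of equal size.

module Submission where

open import Defs
open import Data.Nat using (ℕ; zero; suc; _+_; _≤_; _<_; z≤n; _<ᵇ_)
open import Data.Nat.Properties as ℕ using (module ≤-Reasoning)
open import Data.Bool using (Bool; true; false; _∧_; _∨_; not; if_then_else_)
open import Data.Bool.Properties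
  using (¬-not; ⇔→≡; ∨-identityʳ; ∨-zeroʳ; ∧-identityʳ; ∧-zeroʳ; ∨-comm; ∧-comm; T-≡)
import Data.Bool as Bool
open import Data.Fin using (Fin; zero; suc; toℕ; _≟_; punchIn)
open import Data.Fin.Properties using (toℕ-injective; punchInᵢ≢i; any?; all?; injective⇒≤)
open import Data.List using (List; []; _∷_; map; allFin; tabulate; foldl; cartesianProduct)
open import Data.List.Membership.Propositional using (_∈_; lose)
open import Data.List.Membership.Propositional.Properties using (∈-allFin; ∈-cartesianProduct⁺)
open import Data.List.Relation.Unary.Any using (here; there; satisfied)
open import Data.List.Relation.Unary.Any.Properties using (any⁺; any⁻)
open import Data.Nat.ListAction using (sum)
open import Data.Product using (Σ; _×_; _,_; proj₁; proj₂)
open import Data.Sum using (_⊎_; inj₁; inj₂)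
open import Data.Empty using (⊥; ⊥-elim)
open import Function using (_∘_)
open import Function.Definitions using (Injective)
open import Relation.Nullary using (¬_; ¬?; Dec; yes; no; _×-dec_)
open import Relation.Nullary.Decidable using (toSum)
open import Function.Bundles using (Equivalence; mk⇔)
open import Relation.Binary using (tri<; tri≈; tri>)
open import Relation.Binary.PropositionalEquality
  using (_≡_; _≢_; refl; sym; trans; cong; cong₂; subst; subst₂; module ≡-Reasoning)
open import Algebra.Properties.CommutativeMonoid.Sum ℕ.+-0-commutativeMonoid
  using (sum-cong-≗; sum-remove; ∑-distrib-+; ∑-comm; sum-replicate-zero)
  renaming (sum to ∑)

true≢false : ∀ {b} → b ≡ true → b ≡ false → ⊥
true≢false refl ()

∧-trueˡ : ∀ {a b} → a ∧ b ≡ true → a ≡ true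
∧-trueˡ {true} _ = refl

∧-trueʳ : ∀ {a b} → a ∧ b ≡ true → b ≡ true
∧-trueʳ {true} e = e

∧-true : ∀ {a b} → a ≡ true → b ≡ true → a ∧ b ≡ true
∧-true refl e = e

∨-trueˡ : ∀ {a b} → a ≡ true → a ∨ b ≡ true
∨-trueˡ refl = refl

∨-trueʳ : ∀ {a b} → b ≡ true → a ∨ b ≡ true
∨-trueʳ {true} _ = refl
∨-trueʳ {false} e = e

∨-true⁻ : ∀ {a b} → a ∨ b ≡ true → a ≡ true ⊎ b ≡ true
∨-true⁻ {true} _ = inj₁ refl
∨-true⁻ {false} e = inj₂ e

not-true⁻ : ∀ {a} → not a ≡ true → a ≡ false
not-true⁻ {false} _ = refl

not-false⁻ : ∀ {a} → not a ≡ false → a ≡ true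
not-false⁻ {true} _ = refl

≢true⇒≡false : ∀ {a} → a ≢ true → a ≡ false
≢true⇒≡false {false} _ = refl
≢true⇒≡false {true} ne = ⊥-elim (ne refl)

==-refl : ∀ {n} (u : Fin n) → (u == u) ≡ true
==-refl u with u ≟ u
... | yes _ = refl
... | no u≢u = ⊥-elim (u≢u refl)

==-≢ : ∀ {n} {u v : Fin n} → u ≢ v → (u == v) ≡ false
==-≢ {u = u} {v} u≢v with u ≟ v
... | yes u≡v = ⊥-elim (u≢v u≡v)
... | no _ = refl

==⇒≡ : ∀ {n} {u v : Fin n} → (u == v) ≡ true → u ≡ v
==⇒≡ {u = u} {v} e with u ≟ v
... | yes u≡v = u≡v

-- Finite sums

𝟙 : Bool → ℕ
𝟙 b = if b then 1 else 0

count : ∀ {n} → VSet n → ℕ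
count P = ∑ (𝟙 ∘ P)

sum-map-tabulate : ∀ {A : Set} {m} (f : A → ℕ) (g : Fin m → A) →
  sum (map f (tabulate g)) ≡ ∑ (f ∘ g)
sum-map-tabulate {m = zero} f g = refl
sum-map-tabulate {m = suc m} f g = cong (f (g zero) +_) (sum-map-tabulate f (g ∘ suc))

∣∣V≡count : ∀ {n} (S : VSet n) → ∣ S ∣V ≡ count S
∣∣V≡count S = sum-map-tabulate (𝟙 ∘ S) (λ v → v)

∑-zero : ∀ {n} (f : Fin n → ℕ) → (∀ i → f i ≡ 0) → ∑ f ≡ 0
∑-zero {n} f f≡0 = trans (sum-cong-≗ f≡0) (sum-replicate-zero n)

∑-δ : ∀ {n} (f : Fin n → ℕ) (q : Fin n) → (∀ i → i ≢ q → f i ≡ 0) → ∑ f ≡ f q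
∑-δ {suc n} f q f≡0 = begin
  ∑ f                       ≡⟨ sum-remove {i = q} f ⟩
  f q + ∑ (f ∘ punchIn q)   ≡⟨ cong (f q +_) (∑-zero _ (λ i → f≡0 _ (punchInᵢ≢i q i))) ⟩
  f q + 0                   ≡⟨ ℕ.+-identityʳ (f q) ⟩
  f q                       ∎
  where open ≡-Reasoning

∑-mono : ∀ {n} {f g : Fin n → ℕ} → (∀ i → f i ≤ g i) → ∑ f ≤ ∑ g
∑-mono {zero} _ = z≤n
∑-mono {suc n} f≤g = ℕ.+-mono-≤ (f≤g zero) (∑-mono (f≤g ∘ suc))

count≤1 : ∀ {n} (h : VSet n) → (∀ i j → h i ≡ true → h j ≡ true → i ≡ j) → count h ≤ 1
count≤1 h unique with any? (λ i → h i Bool.≟ true)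
... | yes (i , hi) = ℕ.≤-reflexive (trans (∑-δ (𝟙 ∘ h) i others-zero) (cong 𝟙 hi))
  where
  others-zero : ∀ j → j ≢ i → 𝟙 (h j) ≡ 0
  others-zero j j≢i = cong 𝟙 (≢true⇒≡false (λ hj → j≢i (unique j i hj hi)))
... | no none = subst (_≤ 1) (sym (∑-zero (𝟙 ∘ h) all-zero)) z≤n
  where
  all-zero : ∀ i → 𝟙 (h i) ≡ 0
  all-zero i = cong 𝟙 (≢true⇒≡false (λ hi → none (i , hi)))

count-≤ : ∀ {n} (P Q : VSet n) (f : Fin n → Fin n) →
  (∀ v → P v ≡ true → Q (f v) ≡ true) →
  (∀ u v → P u ≡ true → P v ≡ true → f u ≡ f v → u ≡ v) →
  count P ≤ count Q
count-≤ P Q f into inj = begin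
  ∑ (λ v → 𝟙 (P v))                          ≡⟨ sum-cong-≗ (λ v → sym (fibre-δ v)) ⟩
  ∑ (λ v → ∑ (λ w → 𝟙 (P v ∧ (f v == w))))   ≡⟨ ∑-comm (λ v w → 𝟙 (P v ∧ (f v == w))) ⟩
  ∑ (λ w → ∑ (λ v → 𝟙 (P v ∧ (f v == w))))   ≤⟨ ∑-mono fibre-≤ ⟩
  ∑ (λ w → 𝟙 (Q w))                          ∎
  where
  open ≤-Reasoning
  fibre-δ : ∀ v → ∑ (λ w → 𝟙 (P v ∧ (f v == w))) ≡ 𝟙 (P v)
  fibre-δ v = trans (∑-δ _ (f v) off-image) (cong 𝟙 (trans (cong (P v ∧_) (==-refl (f v))) (∧-identityʳ (P v))))
    where
    off-image : ∀ w → w ≢ f v → 𝟙 (P v ∧ (f v == w)) ≡ 0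
    off-image w w≢fv = cong 𝟙 (trans (cong (P v ∧_) (==-≢ (w≢fv ∘ sym))) (∧-zeroʳ (P v)))
  fibre-≤ : ∀ w → ∑ (λ v → 𝟙 (P v ∧ (f v == w))) ≤ 𝟙 (Q w)
  fibre-≤ w with Q w in Qw
  ... | true = count≤1 _ (λ u v eu ev → inj u v (∧-trueˡ eu) (∧-trueˡ ev)
                 (trans (==⇒≡ (∧-trueʳ {P u} eu)) (sym (==⇒≡ (∧-trueʳ {P v} ev)))))
  ... | false = ℕ.≤-reflexive (∑-zero _ (λ v → cong 𝟙 (≢true⇒≡false (λ e →
                 true≢false (subst (λ z → Q z ≡ true) (==⇒≡ (∧-trueʳ {P v} e)) (into v (∧-trueˡ e))) Qw))))

count-remove : ∀ {n} (Q : VSet n) {a : Fin n} → Q a ≡ true →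
  count Q ≡ suc (count (λ w → Q w ∧ not (w == a)))
count-remove Q {a} Qa = begin
  ∑ (λ w → 𝟙 (Q w))                         ≡⟨ sum-cong-≗ split ⟩
  ∑ (λ w → 𝟙 (w == a) + 𝟙 (Q∖a w))          ≡⟨ ∑-distrib-+ (λ w → 𝟙 (w == a)) (𝟙 ∘ Q∖a) ⟩
  ∑ (λ w → 𝟙 (w == a)) + count Q∖a          ≡⟨ cong (_+ count Q∖a) at-a ⟩
  suc (count Q∖a)                           ∎
  where
  open ≡-Reasoning
  Q∖a : VSet _
  Q∖a w = Q w ∧ not (w == a)
  at-a : ∑ (λ w → 𝟙 (w == a)) ≡ 1
  at-a = trans (∑-δ (λ w → 𝟙 (w == a)) a (λ w → cong 𝟙 ∘ ==-≢)) (cong 𝟙 (==-refl a))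
  split : ∀ w → 𝟙 (Q w) ≡ 𝟙 (w == a) + 𝟙 (Q∖a w)
  split w with w ≟ a
  ... | yes refl rewrite Qa = refl
  ... | no _ = cong 𝟙 (sym (∧-identityʳ (Q w)))

count-< : ∀ {n} (P Q : VSet n) (f : Fin n → Fin n) {a : Fin n} →
  (∀ v → P v ≡ true → Q (f v) ≡ true) →
  (∀ u v → P u ≡ true → P v ≡ true → f u ≡ f v → u ≡ v) →
  Q a ≡ true → (∀ v → P v ≡ true → f v ≢ a) →
  count P < count Q
count-< P Q f {a} into inj Qa missed = begin-strict
  count P                                   ≤⟨ count-≤ P _ f into′ inj ⟩
  count (λ w → Q w ∧ not (w == a))          <⟨ ℕ.n<1+n _ ⟩
  suc (count (λ w → Q w ∧ not (w == a)))    ≡⟨ count-remove Q Qa ⟨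
  count Q                                   ∎
  where
  open ≤-Reasoning
  into′ : ∀ v → P v ≡ true → Q (f v) ∧ not (f v == a) ≡ true
  into′ v Pv = ∧-true (into v Pv) (cong not (==-≢ (missed v Pv)))

-- Edge sets

SymmetricE : ∀ {n} → EdgeSet n → Set
SymmetricE F = ∀ u v → F u v ≡ F v u

sym-true : ∀ {n} {F : EdgeSet n} → SymmetricE F → ∀ {u v} → F u v ≡ true → F v u ≡ true
sym-true F-sym {u} {v} e = trans (F-sym v u) e

_∪E_ : ∀ {n} → EdgeSet n → EdgeSet n → EdgeSet n
(F ∪E F′) u v = F u v ∨ F′ u v

edge : ∀ {n} → Fin n → Fin n → EdgeSet n
edge p q u v = ((u == p) ∧ (v == q)) ∨ ((u == q) ∧ (v == p))

insert : ∀ {n} → EdgeSet n → Fin n → Fin n → EdgeSet n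
insert F p q = F ∪E edge p q

remove : ∀ {n} → EdgeSet n → Fin n → Fin n → EdgeSet n
remove F p q u v = F u v ∧ not (edge p q u v)

edge⁻ : ∀ {n} (p q u v : Fin n) → edge p q u v ≡ true → (u ≡ p × v ≡ q) ⊎ (u ≡ q × v ≡ p)
edge⁻ p q u v e with ∨-true⁻ {(u == p) ∧ (v == q)} e
... | inj₁ e′ = inj₁ (==⇒≡ (∧-trueˡ e′) , ==⇒≡ (∧-trueʳ {u == p} e′))
... | inj₂ e′ = inj₂ (==⇒≡ (∧-trueˡ e′) , ==⇒≡ (∧-trueʳ {u == q} e′))

edge-pq : ∀ {n} (p q : Fin n) → edge p q p q ≡ true
edge-pq p q rewrite ==-refl p | ==-refl q = refl

edge-sym : ∀ {n} (p q : Fin n) → SymmetricE (edge p q)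
edge-sym p q u v = trans (∨-comm ((u == p) ∧ (v == q)) _)
  (cong₂ _∨_ (∧-comm (u == q) (v == p)) (∧-comm (u == p) (v == q)))

edge-swap : ∀ {n} (p q u v : Fin n) → edge p q u v ≡ edge q p u v
edge-swap p q u v = ∨-comm ((u == p) ∧ (v == q)) _

remove-sym : ∀ {n} {F : EdgeSet n} p q → SymmetricE F → SymmetricE (remove F p q)
remove-sym p q F-sym u v = cong₂ _∧_ (F-sym u v) (cong not (edge-sym p q u v))

edge-functional : ∀ {n} {p q u v w : Fin n} → p ≢ q →
  edge p q u v ≡ true → edge p q u w ≡ true → v ≡ w
edge-functional {p = p} {q} {u} {v} {w} p≢q e e′ with edge⁻ p q u v e | edge⁻ p q u w e′
... | inj₁ (_ , refl) | inj₁ (_ , refl) = refl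
... | inj₂ (_ , refl) | inj₂ (_ , refl) = refl
... | inj₁ (refl , _) | inj₂ (u≡q , _) = ⊥-elim (p≢q u≡q)
... | inj₂ (refl , _) | inj₁ (u≡p , _) = ⊥-elim (p≢q (sym u≡p))

upper : ∀ {n} → EdgeSet n → Fin n → Fin n → ℕ
upper F u v = 𝟙 ((toℕ u <ᵇ toℕ v) ∧ F u v)

∣∣E≡∑upper : ∀ {n} (F : EdgeSet n) → ∣ F ∣E ≡ ∑ (λ u → ∑ (upper F u))
∣∣E≡∑upper {n} F = trans (sum-map-tabulate (λ u → sum (map (upper F u) (allFin n))) (λ u → u))
  (sum-cong-≗ (λ u → sum-map-tabulate (upper F u) (λ v → v)))

∣∣E-cong : ∀ {n} {F F′ : EdgeSet n} → (∀ u v → F u v ≡ F′ u v) → ∣ F ∣E ≡ ∣ F′ ∣E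
∣∣E-cong {F = F} {F′} F≡F′ = begin
  ∣ F ∣E                        ≡⟨ ∣∣E≡∑upper F ⟩
  ∑ (λ u → ∑ (upper F u))
    ≡⟨ sum-cong-≗ (λ u → sum-cong-≗ (λ v → cong (λ b → 𝟙 (_ ∧ b)) (F≡F′ u v))) ⟩
  ∑ (λ u → ∑ (upper F′ u))      ≡⟨ ∣∣E≡∑upper F′ ⟨
  ∣ F′ ∣E                       ∎
  where open ≡-Reasoning

∣∣E-mono : ∀ {n} {F F′ : EdgeSet n} → F ⊆E F′ → ∣ F ∣E ≤ ∣ F′ ∣E
∣∣E-mono {F = F} {F′} F⊆F′ = begin
  ∣ F ∣E                        ≡⟨ ∣∣E≡∑upper F ⟩
  ∑ (λ u → ∑ (upper F u))
    ≤⟨ ∑-mono (λ u → ∑-mono (λ v → upper-mono (F u v) (F′ u v) (F⊆F′ u v))) ⟩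
  ∑ (λ u → ∑ (upper F′ u))      ≡⟨ ∣∣E≡∑upper F′ ⟨
  ∣ F′ ∣E                       ∎
  where
  open ≤-Reasoning
  upper-mono : ∀ {c} a b → (a ≡ true → b ≡ true) → 𝟙 (c ∧ a) ≤ 𝟙 (c ∧ b)
  upper-mono {false} _ _ _ = z≤n
  upper-mono {true} false _ _ = z≤n
  upper-mono {true} true _ a⇒b rewrite a⇒b refl = ℕ.≤-refl

∣∪∣E : ∀ {n} (F F′ : EdgeSet n) → (∀ u v → F u v ≡ true → F′ u v ≡ false) →
  ∣ F ∪E F′ ∣E ≡ ∣ F ∣E + ∣ F′ ∣E
∣∪∣E F F′ disjoint = begin
  ∣ F ∪E F′ ∣E
    ≡⟨ ∣∣E≡∑upper (F ∪E F′) ⟩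
  ∑ (λ u → ∑ (upper (F ∪E F′) u))
    ≡⟨ sum-cong-≗ (λ u → sum-cong-≗ (upper-∪ u)) ⟩
  ∑ (λ u → ∑ (λ v → upper F u v + upper F′ u v))
    ≡⟨ sum-cong-≗ (λ u → ∑-distrib-+ (upper F u) (upper F′ u)) ⟩
  ∑ (λ u → ∑ (upper F u) + ∑ (upper F′ u))
    ≡⟨ ∑-distrib-+ (λ u → ∑ (upper F u)) (λ u → ∑ (upper F′ u)) ⟩
  ∑ (λ u → ∑ (upper F u)) + ∑ (λ u → ∑ (upper F′ u))
    ≡⟨ cong₂ _+_ (∣∣E≡∑upper F) (∣∣E≡∑upper F′) ⟨
  ∣ F ∣E + ∣ F′ ∣E
    ∎
  where
  open ≡-Reasoning
  𝟙-∨ : ∀ c a b → (a ≡ true → b ≡ false) → 𝟙 (c ∧ (a ∨ b)) ≡ 𝟙 (c ∧ a) + 𝟙 (c ∧ b)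
  𝟙-∨ false _ _ _ = refl
  𝟙-∨ true true _ a⇒¬b rewrite a⇒¬b refl = refl
  𝟙-∨ true false _ _ = refl
  upper-∪ : ∀ u v → upper (F ∪E F′) u v ≡ upper F u v + upper F′ u v
  upper-∪ u v = 𝟙-∨ (toℕ u <ᵇ toℕ v) (F u v) (F′ u v) (disjoint u v)

∣edge∣E-ordered : ∀ {n} {p q : Fin n} → toℕ p < toℕ q → ∣ edge p q ∣E ≡ 1
∣edge∣E-ordered {p = p} {q} p<q = begin
  ∣ edge p q ∣E
    ≡⟨ ∣∣E≡∑upper (edge p q) ⟩
  ∑ (λ u → ∑ (upper (edge p q) u))
    ≡⟨ ∑-δ _ p (λ u u≢p → ∑-zero (upper (edge p q) u) (λ v → elsewhere (u≢p ∘ proj₁))) ⟩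
  ∑ (upper (edge p q) p)
    ≡⟨ ∑-δ (upper (edge p q) p) q (λ v v≢q → elsewhere (v≢q ∘ proj₂)) ⟩
  𝟙 ((toℕ p <ᵇ toℕ q) ∧ edge p q p q)
    ≡⟨ cong (λ b → 𝟙 (b ∧ edge p q p q)) (Equivalence.to T-≡ (ℕ.<⇒<ᵇ p<q)) ⟩
  𝟙 (edge p q p q)
    ≡⟨ cong 𝟙 (edge-pq p q) ⟩
  1
    ∎
  where
  open ≡-Reasoning
  elsewhere : ∀ {u v} → ¬ (u ≡ p × v ≡ q) → upper (edge p q) u v ≡ 0
  elsewhere {u} {v} not-pq with toℕ u <ᵇ toℕ v in u<v | edge p q u v in e
  ... | false | _ = refl
  ... | true | false = refl
  ... | true | true with edge⁻ p q u v e
  ... | inj₁ uv≡pq = ⊥-elim (not-pq uv≡pq)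
  ... | inj₂ (refl , refl) = ⊥-elim (ℕ.<-asym p<q (ℕ.<ᵇ⇒< _ _ (Equivalence.from T-≡ u<v)))

∣edge∣E : ∀ {n} {p q : Fin n} → p ≢ q → ∣ edge p q ∣E ≡ 1
∣edge∣E {p = p} {q} p≢q with ℕ.<-cmp (toℕ p) (toℕ q)
... | tri< p<q _ _ = ∣edge∣E-ordered p<q
... | tri≈ _ p≡q _ = ⊥-elim (p≢q (toℕ-injective p≡q))
... | tri> _ _ q<p = trans (∣∣E-cong (edge-swap p q)) (∣edge∣E-ordered q<p)

∣insert∣E : ∀ {n} {F : EdgeSet n} {p q : Fin n} → SymmetricE F → F p q ≡ false → p ≢ q →
  ∣ insert F p q ∣E ≡ suc ∣ F ∣E
∣insert∣E {F = F} {p} {q} F-sym Fpq p≢q =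
  trans (∣∪∣E F (edge p q) disjoint) (trans (cong (∣ F ∣E +_) (∣edge∣E p≢q)) (ℕ.+-comm ∣ F ∣E 1))
  where
  disjoint : ∀ u v → F u v ≡ true → edge p q u v ≡ false
  disjoint u v Fuv with edge p q u v in e
  ... | false = refl
  ... | true with edge⁻ p q u v e
  ... | inj₁ (refl , refl) = ⊥-elim (true≢false Fuv Fpq)
  ... | inj₂ (refl , refl) = ⊥-elim (true≢false (sym-true F-sym Fuv) Fpq)

∣remove∣E : ∀ {n} {F : EdgeSet n} {p q : Fin n} → SymmetricE F → F p q ≡ true → p ≢ q →
  ∣ F ∣E ≡ suc ∣ remove F p q ∣E
∣remove∣E {F = F} {p} {q} F-sym Fpq p≢q =
  trans (∣∣E-cong reinsert) (∣insert∣E (remove-sym p q F-sym) removed p≢q)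
  where
  reinsert : ∀ u v → F u v ≡ insert (remove F p q) p q u v
  reinsert u v with edge p q u v in e
  ... | false = sym (trans (∨-identityʳ _) (∧-identityʳ (F u v)))
  ... | true with edge⁻ p q u v e
  ... | inj₁ (refl , refl) = trans Fpq (sym (∨-zeroʳ _))
  ... | inj₂ (refl , refl) = trans (sym-true F-sym Fpq) (sym (∨-zeroʳ _))
  removed : remove F p q p q ≡ false
  removed rewrite edge-pq p q = ∧-zeroʳ (F p q)

module Matching {n} (G : Graph n) where

  Free : EdgeSet n → Fin n → Set
  Free M v = ¬ Saturates M v

  sat? : (M : EdgeSet n) (v : Fin n) → Dec (Saturates M v)
  sat? M v = any? (λ w → M v w Bool.≟ true)

  adj-sym-true : ∀ {u v} → adj G u v ≡ true → adj G v u ≡ true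
  adj-sym-true = sym-true (adj-sym G)

  adj⇒≢ : ∀ {u v} → adj G u v ≡ true → u ≢ v
  adj⇒≢ {u} e refl = true≢false e (adj-irrefl G u)

  saturated≢free : ∀ {M : EdgeSet n} {u v} → Saturates M u → Free M v → u ≢ v
  saturated≢free s f refl = f s

  sat-mono : ∀ {F F′ : EdgeSet n} {v} → F ⊆E F′ → Saturates F v → Saturates F′ v
  sat-mono {v = v} F⊆F′ (w , e) = w , F⊆F′ v w e

  free-mono : ∀ {F F′ : EdgeSet n} {v} → F ⊆E F′ → Free F′ v → Free F v
  free-mono F⊆F′ f (w , e) = f (w , F⊆F′ _ w e)

  remove-⊆ : ∀ (M : EdgeSet n) p q → remove M p q ⊆E M
  remove-⊆ M p q u v = ∧-trueˡ

  module _ {M : EdgeSet n} (m : IsMatching G M) where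

    matching-sym : SymmetricE M
    matching-sym = proj₁ (proj₁ m)

    matched-sym : ∀ {u v} → M u v ≡ true → M v u ≡ true
    matched-sym = sym-true matching-sym

    matched⇒adj : ∀ {u v} → M u v ≡ true → adj G u v ≡ true
    matched⇒adj {u} {v} = proj₂ (proj₁ m) u v

    mate-unique : ∀ {u v w} → M u v ≡ true → M u w ≡ true → v ≡ w
    mate-unique {u} {v} {w} = proj₂ m u v w

    sub-matching : ∀ {F} → SymmetricE F → F ⊆E M → IsMatching G F
    sub-matching F-sym F⊆M =
      (F-sym , λ u v e → matched⇒adj (F⊆M u v e)) , λ u v w e e′ → mate-unique (F⊆M u v e) (F⊆M u w e′)

    remove-matching : ∀ p q → IsMatching G (remove M p q)
    remove-matching p q =
      sub-matching {remove M p q} (remove-sym p q matching-sym) (remove-⊆ M p q)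

    ∣remove∣ : ∀ {p q} → M p q ≡ true → ∣ M ∣E ≡ suc ∣ remove M p q ∣E
    ∣remove∣ Mpq = ∣remove∣E matching-sym Mpq (adj⇒≢ (matched⇒adj Mpq))

    remove-keeps : ∀ {p q s t} → M s t ≡ true → s ≢ p → s ≢ q → remove M p q s t ≡ true
    remove-keeps {p} {q} {s} {t} Mst s≢p s≢q with edge p q s t in e
    ... | false = ∧-true Mst refl
    ... | true with edge⁻ p q s t e
    ... | inj₁ (s≡p , _) = ⊥-elim (s≢p s≡p)
    ... | inj₂ (s≡q , _) = ⊥-elim (s≢q s≡q)

    remove-freesˡ : ∀ {p q} → M p q ≡ true → Free (remove M p q) p
    remove-freesˡ {p} {q} Mpq (w , e) with mate-unique Mpq (∧-trueˡ e)
    ... | refl rewrite edge-pq p q = true≢false e (∧-zeroʳ (M p q))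

    remove-freesʳ : ∀ {p q} → M p q ≡ true → Free (remove M p q) q
    remove-freesʳ {p} {q} Mpq (w , e) with mate-unique (matched-sym Mpq) (∧-trueˡ e)
    ... | refl rewrite edge-sym p q q p | edge-pq p q = true≢false e (∧-zeroʳ (M q p))

    insert-matching : ∀ {p q} → adj G p q ≡ true → Free M p → Free M q → IsMatching G (insert M p q)
    insert-matching {p} {q} a fp fq = (insert-sym , in-graph) , unique
      where
      insert-sym : SymmetricE (insert M p q)
      insert-sym u v = cong₂ _∨_ (matching-sym u v) (edge-sym p q u v)
      in-graph : ∀ u v → insert M p q u v ≡ true → adj G u v ≡ true
      in-graph u v e with ∨-true⁻ {M u v} e
      ... | inj₁ Muv = matched⇒adj Muv
      ... | inj₂ e′ with edge⁻ p q u v e′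
      ... | inj₁ (refl , refl) = a
      ... | inj₂ (refl , refl) = adj-sym-true a
      endpoint-free : ∀ {u v} → edge p q u v ≡ true → Free M u
      endpoint-free {u} {v} e with edge⁻ p q u v e
      ... | inj₁ (refl , _) = fp
      ... | inj₂ (refl , _) = fq
      unique : ∀ u v w → insert M p q u v ≡ true → insert M p q u w ≡ true → v ≡ w
      unique u v w e e′ with ∨-true⁻ {M u v} e | ∨-true⁻ {M u w} e′
      ... | inj₁ Muv | inj₁ Muw = mate-unique Muv Muw
      ... | inj₁ Muv | inj₂ puw = ⊥-elim (endpoint-free {u} {w} puw (v , Muv))
      ... | inj₂ puv | inj₁ Muw = ⊥-elim (endpoint-free {u} {v} puv (w , Muw))
      ... | inj₂ puv | inj₂ puw = edge-functional {u = u} (adj⇒≢ a) puv puw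

    ∣insert∣ : ∀ {p q} → Free M p → p ≢ q → ∣ insert M p q ∣E ≡ suc ∣ M ∣E
    ∣insert∣ {p} {q} fp = ∣insert∣E matching-sym (≢true⇒≡false (λ Mpq → fp (q , Mpq)))

  insert-⊇ : ∀ (M : EdgeSet n) p q → M ⊆E insert M p q
  insert-⊇ M p q u v = ∨-trueˡ {M u v}

  insert-pq : ∀ (M : EdgeSet n) p q → insert M p q p q ≡ true
  insert-pq M p q = ∨-trueʳ {M p q} {edge p q p q} (edge-pq p q)

  free-insert : ∀ {M z p q} → Free M z → z ≢ p → z ≢ q → Free (insert M p q) z
  free-insert {M} {z} {p} {q} fz z≢p z≢q (w , e) with ∨-true⁻ {M z w} e
  ... | inj₁ Mzw = fz (w , Mzw)
  ... | inj₂ e′ with edge⁻ p q z w e′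
  ... | inj₁ (z≡p , _) = z≢p z≡p
  ... | inj₂ (z≡q , _) = z≢q z≡q

  shift : EdgeSet n → Fin n → Fin n → Fin n → EdgeSet n
  shift M v w z = insert (remove M v w) w z

  module _ {M : EdgeSet n} (m : IsMatching G M) {v w z : Fin n}
           (Mvw : M v w ≡ true) (awz : adj G w z ≡ true) (fz : Free M z) where

    private
      w-freed : Free (remove M v w) w
      w-freed = remove-freesʳ m Mvw

    shift-matching : IsMatching G (shift M v w z)
    shift-matching = insert-matching (remove-matching m v w) awz w-freed (free-mono (remove-⊆ M v w) fz)

    ∣shift∣ : ∣ shift M v w z ∣E ≡ ∣ M ∣E
    ∣shift∣ = trans (∣insert∣ (remove-matching m v w) w-freed (adj⇒≢ awz)) (sym (∣remove∣ m Mvw))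

    shift-frees : Free (shift M v w z) v
    shift-frees = free-insert {remove M v w} (remove-freesˡ m Mvw)
      (adj⇒≢ (matched⇒adj m Mvw)) (saturated≢free {M} (w , Mvw) fz)

    shift-keeps-free : ∀ {y} → Free M y → y ≢ z → Free (shift M v w z) y
    shift-keeps-free fy y≢z =
      free-insert {remove M v w} (free-mono (remove-⊆ M v w) fy)
        (saturated≢free {M} (v , matched-sym m Mvw) fy ∘ sym) y≢z

    shift-keeps : ∀ {s t} → M s t ≡ true → s ≢ v → s ≢ w → shift M v w z s t ≡ true
    shift-keeps {s} {t} Mst s≢v s≢w = insert-⊇ (remove M v w) w z s t (remove-keeps m Mst s≢v s≢w)

    shift-keeps-saturated : ∀ {y} → Saturates M y → y ≢ v → Saturates (shift M v w z) y
    shift-keeps-saturated {y} (t , Myt) y≢v with toSum (y ≟ w)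
    ... | inj₁ refl = z , insert-pq (remove M v w) w z
    ... | inj₂ y≢w = t , shift-keeps Myt y≢v y≢w

  ∅ : EdgeSet n
  ∅ _ _ = false

  ∅-matching : IsMatching G ∅
  ∅-matching = ((λ _ _ → refl) , λ _ _ ()) , λ _ _ _ ()

  Dominating : EdgeSet n → Set
  Dominating M = ∀ u v → adj G u v ≡ true → Saturates M u ⊎ Saturates M v

  FreeEdge : EdgeSet n → Fin n → Fin n → Set
  FreeEdge M p q = adj G p q ≡ true × Free M p × Free M q

  freeEdge? : ∀ M p q → Dec (FreeEdge M p q)
  freeEdge? M p q = (adj G p q Bool.≟ true) ×-dec (¬? (sat? M p) ×-dec ¬? (sat? M q))

  dominating-or-freeEdge : ∀ M → Dominating M ⊎ Σ (Fin n) (λ p → Σ (Fin n) (FreeEdge M p))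
  dominating-or-freeEdge M with any? (λ p → any? (freeEdge? M p))
  ... | yes (p , q , pq) = inj₂ (p , q , pq)
  ... | no none = inj₁ dominating
    where
    dominating : Dominating M
    dominating u v a with sat? M u | sat? M v
    ... | yes su | _ = inj₁ su
    ... | no _ | yes sv = inj₂ sv
    ... | no fu | no fv = ⊥-elim (none (u , v , a , fu , fv))

  dominating⇒maximal : ∀ {M} → IsMatching G M → Dominating M → IsMaximalMatching G M
  dominating⇒maximal {M} m dom =
    m , λ M′ m′ M⊆M′ u v M′uv → mate-in-M M′ m′ M⊆M′ M′uv (dom u v (matched⇒adj m′ M′uv))
    where
    mate-in-M : ∀ M′ → IsMatching G M′ → M ⊆E M′ → ∀ {u v} → M′ u v ≡ true →
      Saturates M u ⊎ Saturates M v → M u v ≡ true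
    mate-in-M M′ m′ M⊆M′ {u} M′uv (inj₁ (w , Muw)) with mate-unique m′ M′uv (M⊆M′ u w Muw)
    ... | refl = Muw
    mate-in-M M′ m′ M⊆M′ {v = v} M′uv (inj₂ (w , Mvw))
      with mate-unique m′ (matched-sym m′ M′uv) (M⊆M′ v w Mvw)
    ... | refl = matched-sym m Mvw

  maximal⇒dominating : ∀ {M} → IsMaximalMatching G M → Dominating M
  maximal⇒dominating {M} (m , maximal) u v a with sat? M u | sat? M v
  ... | yes su | _ = inj₁ su
  ... | no _ | yes sv = inj₂ sv
  ... | no fu | no fv =
    ⊥-elim (fu (v , maximal (insert M u v) (insert-matching m a fu fv) (insert-⊇ M u v) u v (insert-pq M u v)))

  maximal⇒minimalEDS : ∀ {M} → IsMaximalMatching G M → IsMinimalEDS G M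
  maximal⇒minimalEDS {M} mm@(m , _) = (proj₁ m , dominates) , minimal
    where
    dominates : Dominates G M
    dominates u v a with maximal⇒dominating mm u v a
    ... | inj₁ (w , Muw) = inj₂ (w , inj₁ Muw)
    ... | inj₂ (w , Mvw) = inj₂ (w , inj₂ Mvw)
    minimal : ∀ F → IsEDS G F → F ⊆E M → M ⊆E F
    minimal F ((F-sym , _) , F-dom) F⊆M u v Muv with F-dom u v (matched⇒adj m Muv)
    ... | inj₁ Fuv = Fuv
    ... | inj₂ (w , inj₁ Fuw) with mate-unique m Muv (F⊆M u w Fuw)
    ... | refl = Fuw
    minimal F ((F-sym , _) , F-dom) F⊆M u v Muv | inj₂ (w , inj₂ Fvw)
      with mate-unique m (matched-sym m Muv) (F⊆M v w Fvw)
    ... | refl = sym-true F-sym Fvw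

  grow : EdgeSet n → Fin n × Fin n → EdgeSet n
  grow M (p , q) with freeEdge? M p q
  ... | yes _ = insert M p q
  ... | no _ = M

  grow-matching : ∀ {M} pq → IsMatching G M → IsMatching G (grow M pq)
  grow-matching {M} (p , q) m with freeEdge? M p q
  ... | yes (a , fp , fq) = insert-matching m a fp fq
  ... | no _ = m

  grow-⊇ : ∀ M pq → M ⊆E grow M pq
  grow-⊇ M (p , q) with freeEdge? M p q
  ... | yes _ = insert-⊇ M p q
  ... | no _ = λ _ _ e → e

  grow-touches : ∀ M {p q} → adj G p q ≡ true → Saturates (grow M (p , q)) p ⊎ Saturates (grow M (p , q)) q
  grow-touches M {p} {q} a with freeEdge? M p q
  ... | yes _ = inj₁ (q , insert-pq M p q)
  ... | no ¬free with sat? M p | sat? M q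
  ... | yes sp | _ = inj₁ sp
  ... | no _ | yes sq = inj₂ sq
  ... | no fp | no fq = ⊥-elim (¬free (a , fp , fq))

  grow* : EdgeSet n → List (Fin n × Fin n) → EdgeSet n
  grow* = foldl grow

  grow*-matching : ∀ {M} pqs → IsMatching G M → IsMatching G (grow* M pqs)
  grow*-matching [] m = m
  grow*-matching (pq ∷ pqs) m = grow*-matching pqs (grow-matching pq m)

  grow*-⊇ : ∀ M pqs → M ⊆E grow* M pqs
  grow*-⊇ M [] u v e = e
  grow*-⊇ M (pq ∷ pqs) u v e = grow*-⊇ (grow M pq) pqs u v (grow-⊇ M pq u v e)

  grow*-touches : ∀ M pqs {p q} → (p , q) ∈ pqs → adj G p q ≡ true →
    Saturates (grow* M pqs) p ⊎ Saturates (grow* M pqs) q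
  grow*-touches M (_ ∷ pqs) {p} {q} (here refl) a with grow-touches M a
  ... | inj₁ sp = inj₁ (sat-mono (grow*-⊇ (grow M (p , q)) pqs) sp)
  ... | inj₂ sq = inj₂ (sat-mono (grow*-⊇ (grow M (p , q)) pqs) sq)
  grow*-touches M (pq ∷ pqs) (there i) a = grow*-touches (grow M pq) pqs i a

  allPairs : List (Fin n × Fin n)
  allPairs = cartesianProduct (allFin n) (allFin n)

  extend : EdgeSet n → EdgeSet n
  extend M = grow* M allPairs

  extend-⊇ : ∀ M → M ⊆E extend M
  extend-⊇ M = grow*-⊇ M allPairs

  extend-maximal : ∀ {M} → IsMatching G M → IsMaximalMatching G (extend M)
  extend-maximal {M} m = dominating⇒maximal (grow*-matching allPairs m)
    (λ u v → grow*-touches M allPairs (∈-cartesianProduct⁺ (∈-allFin u) (∈-allFin v)))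

-- Induced subgraphs

restrict : ∀ {n} → EdgeSet n → VSet n → EdgeSet n
restrict F S u v = S u ∧ (S v ∧ F u v)

restrict⁻ : ∀ {n} (F : EdgeSet n) S {u v} → restrict F S u v ≡ true → S u ≡ true × S v ≡ true × F u v ≡ true
restrict⁻ F S {u} e = ∧-trueˡ e , ∧-trueˡ (∧-trueʳ {S u} e) , ∧-trueʳ (∧-trueʳ {S u} e)

restrict⁺ : ∀ {n} (F : EdgeSet n) S {u v} → S u ≡ true → S v ≡ true → F u v ≡ true → restrict F S u v ≡ true
restrict⁺ F S Su Sv Fuv = ∧-true Su (∧-true Sv Fuv)

restrict-sym : ∀ {n} (F : EdgeSet n) S → SymmetricE F → SymmetricE (restrict F S)
restrict-sym F S F-sym u v = ⇔→≡ (mk⇔ flip flip)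
  where
  flip : ∀ {u v} → restrict F S u v ≡ true → restrict F S v u ≡ true
  flip e = let (Su , Sv , Fuv) = restrict⁻ F S e in restrict⁺ F S Sv Su (sym-true F-sym Fuv)

restrict-cong : ∀ {n} {F F′ : EdgeSet n} S → (∀ {u v} → S u ≡ true → S v ≡ true → F u v ≡ F′ u v) →
  ∀ u v → restrict F S u v ≡ restrict F′ S u v
restrict-cong S F≡F′ u v with S u in Su | S v in Sv
... | true | true = F≡F′ Su Sv
... | true | false = refl
... | false | _ = refl

restrict-⊆ : ∀ {n} (F : EdgeSet n) S → restrict F S ⊆E F
restrict-⊆ F S u v e = proj₂ (proj₂ (restrict⁻ F S e))

Closed : ∀ {n} → EdgeSet n → VSet n → Set
Closed M S = ∀ u w → S u ≡ true → M u w ≡ true → S w ≡ true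

module _ {n} (G : Graph n) where
  open Matching G
  private module Sub (S : VSet n) = Matching (Induced G S)

  restrict-saturates : ∀ {M : EdgeSet n} {S v} → Closed M S → S v ≡ true →
    Saturates M v → Saturates (restrict M S) v
  restrict-saturates {M} {S} {v} closed Sv (w , Mvw) = w , restrict⁺ M S Sv (closed v w Sv Mvw) Mvw

  restrict-matching : ∀ {M} S → IsMatching G M → IsMatching (Induced G S) (restrict M S)
  restrict-matching {M} S m = (restrict-sym M S (matching-sym m) , in-graph) , unique
    where
    in-graph : ∀ u v → restrict M S u v ≡ true → adj (Induced G S) u v ≡ true
    in-graph u v e = let (Su , Sv , Muv) = restrict⁻ M S e in restrict⁺ (adj G) S Su Sv (matched⇒adj m Muv)
    unique : ∀ u v w → restrict M S u v ≡ true → restrict M S u w ≡ true → v ≡ w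
    unique u v w e e′ = mate-unique m (restrict-⊆ M S u v e) (restrict-⊆ M S u w e′)

  spliced-matching : ∀ {M M′ C R} → IsMatching G M → IsMatching G M′ →
    (∀ {v} → C v ≡ true → R v ≡ false) → IsMatching G (restrict M C ∪E restrict M′ R)
  spliced-matching {M} {M′} {C} {R} m m′ disjoint = (splice-sym , in-graph) , unique
    where
    N : EdgeSet n
    N = restrict M C ∪E restrict M′ R
    splice-sym : SymmetricE N
    splice-sym u v = cong₂ _∨_ (restrict-sym M C (matching-sym m) u v) (restrict-sym M′ R (matching-sym m′) u v)
    in-graph : ∀ u v → N u v ≡ true → adj G u v ≡ true
    in-graph u v e with ∨-true⁻ {restrict M C u v} e
    ... | inj₁ e′ = matched⇒adj m (restrict-⊆ M C u v e′)
    ... | inj₂ e′ = matched⇒adj m′ (restrict-⊆ M′ R u v e′)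
    unique : ∀ u v w → N u v ≡ true → N u w ≡ true → v ≡ w
    unique u v w e e′ with ∨-true⁻ {restrict M C u v} e | ∨-true⁻ {restrict M C u w} e′
    ... | inj₁ ev | inj₁ ew = mate-unique m (restrict-⊆ M C u v ev) (restrict-⊆ M C u w ew)
    ... | inj₂ ev | inj₂ ew = mate-unique m′ (restrict-⊆ M′ R u v ev) (restrict-⊆ M′ R u w ew)
    ... | inj₁ ev | inj₂ ew = ⊥-elim (true≢false (proj₁ (restrict⁻ M′ R ew)) (disjoint (proj₁ (restrict⁻ M C ev))))
    ... | inj₂ ev | inj₁ ew = ⊥-elim (true≢false (proj₁ (restrict⁻ M′ R ev)) (disjoint (proj₁ (restrict⁻ M C ew))))

  restrict-maximal : ∀ {M} S → IsMaximalMatching G M → Closed M S →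
    IsMaximalMatching (Induced G S) (restrict M S)
  restrict-maximal {M} S mm closed = Sub.dominating⇒maximal S (restrict-matching S (proj₁ mm)) dominating
    where
    dominating : Sub.Dominating S (restrict M S)
    dominating u v e with restrict⁻ (adj G) S e
    ... | (Su , Sv , a) with maximal⇒dominating mm u v a
    ... | inj₁ su = inj₁ (restrict-saturates {M} {S} closed Su su)
    ... | inj₂ sv = inj₂ (restrict-saturates {M} {S} closed Sv sv)

  ∣restrict∣-split : ∀ {M} S → IsMatching G M → Closed M S →
    ∣ M ∣E ≡ ∣ restrict M S ∣E + ∣ restrict M (not ∘ S) ∣E
  ∣restrict∣-split {M} S m closed = trans (∣∣E-cong split) (∣∪∣E (restrict M S) (restrict M (not ∘ S)) disjoint)
    where
    split : ∀ u v → M u v ≡ (restrict M S u v ∨ restrict M (not ∘ S) u v)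
    split u v with S u in Su | S v in Sv | M u v in Muv
    ... | true  | true  | _     = sym (∨-identityʳ _)
    ... | false | false | _     = refl
    ... | true  | false | false = refl
    ... | false | true  | false = refl
    ... | true  | false | true  = ⊥-elim (true≢false (closed u v Su Muv) Sv)
    ... | false | true  | true  = ⊥-elim (true≢false (closed v u Sv (matched-sym m Muv)) Su)
    disjoint : ∀ u v → restrict M S u v ≡ true → restrict M (not ∘ S) u v ≡ false
    disjoint u v e rewrite ∧-trueˡ {S u} e = refl

module WellEdgeDominatedMatchings {n} (G : Graph n) (wed : WellEdgeDominated G) where
  open Matching G

  ν : ℕ
  ν = ∣ extend ∅ ∣E

  maximal-same-size : ∀ {M M′} → IsMaximalMatching G M → IsMaximalMatching G M′ → ∣ M ∣E ≡ ∣ M′ ∣E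
  maximal-same-size mm mm′ = wed _ _ (maximal⇒minimalEDS mm) (maximal⇒minimalEDS mm′)

  ∣maximal∣≡ν : ∀ {M} → IsMaximalMatching G M → ∣ M ∣E ≡ ν
  ∣maximal∣≡ν mm = maximal-same-size mm (extend-maximal ∅-matching)

  ∣matching∣≤ν : ∀ {M} → IsMatching G M → ∣ M ∣E ≤ ν
  ∣matching∣≤ν {M} m =
    ℕ.≤-trans (∣∣E-mono (extend-⊇ M)) (ℕ.≤-reflexive (∣maximal∣≡ν (extend-maximal m)))

  maximum-no-freeEdge : ∀ {M p q} → IsMatching G M → ∣ M ∣E ≡ ν → ¬ FreeEdge M p q
  maximum-no-freeEdge {M} {p} {q} m M≡ν (a , fp , fq) = ℕ.<-irrefl refl (begin-strict
    ν                        ≡⟨ M≡ν ⟨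
    ∣ M ∣E                   <⟨ ℕ.n<1+n _ ⟩
    suc ∣ M ∣E               ≡⟨ ∣insert∣ m fp (adj⇒≢ a) ⟨
    ∣ insert M p q ∣E        ≤⟨ ∣matching∣≤ν (insert-matching m a fp fq) ⟩
    ν                        ∎)
    where open ≤-Reasoning

  deficient-has-freeEdge : ∀ {M} → IsMatching G M → suc ∣ M ∣E ≡ ν →
    Σ (Fin n) λ p → Σ (Fin n) (FreeEdge M p)
  deficient-has-freeEdge {M} m 1+M≡ν with dominating-or-freeEdge M
  ... | inj₂ pq = pq
  ... | inj₁ dom = ⊥-elim (ℕ.1+n≢n (trans 1+M≡ν (sym (∣maximal∣≡ν (dominating⇒maximal m dom)))))

module BipartiteWellEdgeDominated {n} (G : Graph n) (wed : WellEdgeDominated G)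
                                  (side : VSet n) (bip : IsBipartition G side) where
  open Matching G
  open WellEdgeDominatedMatchings G wed

  opposite : ∀ {u v s} → adj G u v ≡ true → side u ≡ s → side v ≡ not s
  opposite {u} {v} a refl = ¬-not (bip u v a ∘ sym)

  different-sides : ∀ {u v} → side u ≡ true → side v ≡ false → u ≢ v
  different-sides su sv refl = true≢false su sv

  module _ {b : Fin n} (sb : side b ≡ false) where

    Unlinked : Fin n → Set
    Unlinked y = ∀ {M} → IsMatching G M → ∣ M ∣E ≡ ν → Free M y → Free M b → ⊥

    -- The walk a v₁ v₂ … b leaves a free and v₁, v₂ matched to w ≠ v₂ and u. Trading
    -- v₁w and v₂u for v₁v₂ gives a matching of size ν − 1, so some edge joins two of its
    -- free vertices, i.e. two vertices among the N-free ones, w and u; re-matching along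
    -- that edge produces a matching of size ν leaving free either two adjacent vertices
    -- or both v₂ and b.
    module TwoMates {a v₁ v₂ w u : Fin n} {N : EdgeSet n} (m : IsMatching G N) (N≡ν : ∣ N ∣E ≡ ν)
                    (a₁ : adj G a v₁ ≡ true) (a₂ : adj G v₁ v₂ ≡ true) (sa : side a ≡ true)
                    (IH : Unlinked v₂) (fa : Free N a) (fb : Free N b)
                    (v₁w : N v₁ w ≡ true) (v₂u : N v₂ u ≡ true) (w≢v₂ : w ≢ v₂) where

      private
        s₁ : side v₁ ≡ false
        s₁ = opposite a₁ sa
        s₂ : side v₂ ≡ true
        s₂ = opposite a₂ s₁
        sw : side w ≡ true
        sw = opposite (matched⇒adj m v₁w) s₁
        su : side u ≡ false
        su = opposite (matched⇒adj m v₂u) s₂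

      ¬free-neighbour-w : ∀ {z} → adj G w z ≡ true → Free N z → ⊥
      ¬free-neighbour-w awz fz =
        maximum-no-freeEdge (shift-matching m v₁w awz fz) (trans (∣shift∣ m v₁w awz fz) N≡ν)
        (a₁ , shift-keeps-free m v₁w awz fz fa (different-sides sa (opposite awz sw)) , shift-frees m v₁w awz fz)

      ¬free-neighbour-u : ∀ {z} → adj G u z ≡ true → Free N z → ⊥
      ¬free-neighbour-u auz fz = IH (shift-matching m v₂u auz fz) (trans (∣shift∣ m v₂u auz fz) N≡ν)
        (shift-frees m v₂u auz fz) (shift-keeps-free m v₂u auz fz fb (different-sides (opposite auz su) sb ∘ sym))

      ¬edge-wu : adj G w u ≡ true → ⊥
      ¬edge-wu awu = IH m″ (trans (∣shift∣ m′ N′v₂u uw fw′) (trans (∣shift∣ m wv₁ v₁a fa) N≡ν))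
        (shift-frees m′ N′v₂u uw fw′)
        (shift-keeps-free m′ N′v₂u uw fw′ (shift-keeps-free m wv₁ v₁a fa fb (different-sides sa sb ∘ sym))
                          (different-sides sw sb ∘ sym))
        where
        wv₁ = matched-sym m v₁w
        v₁a = adj-sym-true a₁
        uw = adj-sym-true awu
        m′ = shift-matching m wv₁ v₁a fa
        N′v₂u = shift-keeps m wv₁ v₁a fa v₂u (w≢v₂ ∘ sym) (adj⇒≢ a₂ ∘ sym)
        fw′ = shift-frees m wv₁ v₁a fa
        m″ = shift-matching m′ N′v₂u uw fw′

      private
        D = remove N v₂ u
        mD = remove-matching m v₂ u
        Dwv₁ : D w v₁ ≡ true
        Dwv₁ = remove-keeps m (matched-sym m v₁w) w≢v₂ (different-sides sw su)
        fv₂ : Free D v₂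
        fv₂ = remove-freesˡ m v₂u
        N₂ = shift D w v₁ v₂
        m₂ = shift-matching mD Dwv₁ a₂ fv₂
        ∣N₂∣ : suc ∣ N₂ ∣E ≡ ν
        ∣N₂∣ = trans (cong suc (∣shift∣ mD Dwv₁ a₂ fv₂)) (trans (sym (∣remove∣ m v₂u)) N≡ν)

      Freed : Fin n → Set
      Freed y = Free N y ⊎ y ≡ w ⊎ y ≡ u

      freed : ∀ {y} → Free N₂ y → Freed y
      freed {y} fy with toSum (y ≟ w) | toSum (y ≟ u)
      ... | inj₁ y≡w | _ = inj₂ (inj₁ y≡w)
      ... | inj₂ _ | inj₁ y≡u = inj₂ (inj₂ y≡u)
      ... | inj₂ y≢w | inj₂ y≢u = inj₁ λ (t , Nyt) →
        fy (shift-keeps-saturated mD Dwv₁ a₂ fv₂ (t , remove-keeps m Nyt y≢v₂ y≢u) y≢w)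
        where
        y≢v₂ : y ≢ v₂
        y≢v₂ refl = fy (v₁ , matched-sym m₂ (insert-pq (remove D w v₁) v₁ v₂))

      no-edge-among-freed : ∀ {p q} → adj G p q ≡ true → Freed p → Freed q → ⊥
      no-edge-among-freed a (inj₁ fp) (inj₁ fq) = maximum-no-freeEdge m N≡ν (a , fp , fq)
      no-edge-among-freed a (inj₁ fp) (inj₂ (inj₁ refl)) = ¬free-neighbour-w (adj-sym-true a) fp
      no-edge-among-freed a (inj₁ fp) (inj₂ (inj₂ refl)) = ¬free-neighbour-u (adj-sym-true a) fp
      no-edge-among-freed a (inj₂ (inj₁ refl)) (inj₁ fq) = ¬free-neighbour-w a fq
      no-edge-among-freed a (inj₂ (inj₂ refl)) (inj₁ fq) = ¬free-neighbour-u a fq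
      no-edge-among-freed a (inj₂ (inj₁ refl)) (inj₂ (inj₁ refl)) = adj⇒≢ a refl
      no-edge-among-freed a (inj₂ (inj₂ refl)) (inj₂ (inj₂ refl)) = adj⇒≢ a refl
      no-edge-among-freed a (inj₂ (inj₁ refl)) (inj₂ (inj₂ refl)) = ¬edge-wu a
      no-edge-among-freed a (inj₂ (inj₂ refl)) (inj₂ (inj₁ refl)) = ¬edge-wu (adj-sym-true a)

      impossible : ⊥
      impossible with deficient-has-freeEdge m₂ ∣N₂∣
      ... | p , q , apq , fp , fq = no-edge-among-freed apq (freed fp) (freed fq)

    unlinked-step : ∀ {a v₁ v₂} → adj G a v₁ ≡ true → adj G v₁ v₂ ≡ true → side a ≡ true →
      Unlinked v₂ → Unlinked a
    unlinked-step {a} {v₁} {v₂} a₁ a₂ sa IH {N} m N≡ν fa fb with sat? N v₁ | sat? N v₂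
    ... | no f₁ | _ = maximum-no-freeEdge m N≡ν (a₁ , fa , f₁)
    ... | yes _ | no f₂ = IH m N≡ν f₂ fb
    ... | yes (w , v₁w) | yes (u , v₂u) with toSum (w ≟ v₂)
    ... | inj₂ w≢v₂ = TwoMates.impossible m N≡ν a₁ a₂ sa IH fa fb v₁w v₂u w≢v₂
    ... | inj₁ refl = IH (shift-matching m v₂v₁ v₁a fa) (trans (∣shift∣ m v₂v₁ v₁a fa) N≡ν)
      (shift-frees m v₂v₁ v₁a fa) (shift-keeps-free m v₂v₁ v₁a fa fb (different-sides sa sb ∘ sym))
      where
      v₂v₁ = matched-sym m v₁w
      v₁a = adj-sym-true a₁

    unlinked : ∀ {a} → Reach G a b → side a ≡ true → Unlinked a
    unlinked here sa = ⊥-elim (true≢false sa sb)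
    unlinked (step a₁ here) sa m M≡ν fa fb = maximum-no-freeEdge m M≡ν (a₁ , fa , fb)
    unlinked (step a₁ (step a₂ r)) sa = unlinked-step a₁ a₂ sa (unlinked r (opposite a₂ (opposite a₁ sa)))

  saturating-B⇒B<A : ∀ {M a} → IsMatching G M → (∀ v → side v ≡ false → Saturates M v) →
    side a ≡ true → Free M a → count (not ∘ side) < count side
  saturating-B⇒B<A {M} {a} m B-saturated sa fa = count-< (not ∘ side) side mate into injective sa missed
    where
    mate : Fin n → Fin n
    mate v with sat? M v
    ... | yes (w , _) = w
    ... | no _ = v
    mated : ∀ v → side v ≡ false → M v (mate v) ≡ true
    mated v sv with sat? M v
    ... | yes (w , Mvw) = Mvw
    ... | no fv = ⊥-elim (fv (B-saturated v sv))
    into : ∀ v → not (side v) ≡ true → side (mate v) ≡ true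
    into v Bv = opposite (matched⇒adj m (mated v (not-true⁻ Bv))) (not-true⁻ Bv)
    injective : ∀ u v → not (side u) ≡ true → not (side v) ≡ true → mate u ≡ mate v → u ≡ v
    injective u v Bu Bv eq = mate-unique m (matched-sym m (subst (λ z → M u z ≡ true) eq (mated u (not-true⁻ Bu))))
                                           (matched-sym m (mated v (not-true⁻ Bv)))
    missed : ∀ v → not (side v) ≡ true → mate v ≢ a
    missed v Bv eq = fa (v , matched-sym m (subst (λ z → M v z ≡ true) eq (mated v (not-true⁻ Bv))))

  saturating-A⇒maximal : ∀ {M} → IsMatching G M → (∀ {a} → side a ≡ true → Saturates M a) →
    IsMaximalMatching G M
  saturating-A⇒maximal m saturates = dominating⇒maximal m dominating
    where
    dominating : Dominating _
    dominating u v a with side u in su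
    ... | true = inj₁ (saturates su)
    ... | false = inj₂ (saturates (opposite a su))

  maximal-saturates-A : Connected G → ∣ side ∣V ≤ ∣ (λ v → not (side v)) ∣V →
    ∀ {M} → IsMaximalMatching G M → ∀ {a} → side a ≡ true → Saturates M a
  maximal-saturates-A conn A≤B {M} mm@(m , _) {a} sa with sat? M a
  ... | yes sat = sat
  ... | no fa with any? (λ b → (side b Bool.≟ false) ×-dec ¬? (sat? M b))
  ... | yes (b , sb , fb) = ⊥-elim (unlinked sb (conn a b) sa m (∣maximal∣≡ν mm) fa fb)
  ... | no none = ⊥-elim (ℕ.<⇒≱ (saturating-B⇒B<A m B-saturated sa fa)
                                 (subst₂ _≤_ (∣∣V≡count side) (∣∣V≡count (not ∘ side)) A≤B))
    where
    B-saturated : ∀ v → side v ≡ false → Saturates M v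
    B-saturated v sv with sat? M v
    ... | yes s = s
    ... | no fv = ⊥-elim (none (v , sv , fv))

module CutVertex {n} (G : Graph n) (x : Fin n) where
  open Matching G

  ClosedInDelete : VSet n → Set
  ClosedInDelete T = ∀ {u w} → adj G u w ≡ true → u ≢ x → w ≢ x → T u ≡ true → T w ≡ true

  matching-closed : ∀ {M T} → IsMatching G M → ClosedInDelete T →
    (∀ {w} → M x w ≡ true → T w ≡ T x) → Closed M T
  matching-closed m T-closed x-mate u w Tu Muw with toSum (u ≟ x) | toSum (w ≟ x)
  ... | inj₁ refl | _ = trans (x-mate Muw) Tu
  ... | inj₂ _ | inj₁ refl = trans (sym (x-mate (matched-sym m Muw))) Tu
  ... | inj₂ u≢x | inj₂ w≢x = T-closed (matched⇒adj m Muw) u≢x w≢x Tu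

  through : Fin n → EdgeSet n
  through y = extend (insert ∅ x y)

  module _ {y} (axy : adj G x y ≡ true) where

    through-maximal : IsMaximalMatching G (through y)
    through-maximal = extend-maximal (insert-matching ∅-matching axy (λ { (_ , ()) }) (λ { (_ , ()) }))

    through-xy : through y x y ≡ true
    through-xy = extend-⊇ (insert ∅ x y) x y (insert-pq ∅ x y)

    through-mate : ∀ {w} → through y x w ≡ true → w ≡ y
    through-mate e = mate-unique (proj₁ through-maximal) e through-xy

  delete-adj : ∀ {u w} → u ≢ x → w ≢ x → adj G u w ≡ true → adj (Delete G x) u w ≡ true
  delete-adj u≢x w≢x a = ∧-true (cong not (==-≢ u≢x)) (∧-true (cong not (==-≢ w≢x)) a)

  module Component {C : VSet n} (ic : IsComponentOfDelete G x C) where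

    avoids-x : ∀ {u} → C u ≡ true → u ≢ x
    avoids-x Cu refl = true≢false Cu (proj₁ ic)

    closed : ClosedInDelete C
    closed {u} {w} a u≢x w≢x Cu = proj₂ (proj₂ (proj₂ ic) u w Cu w≢x) (step (delete-adj u≢x w≢x a) here)

    neighbour : Connected G → Σ (Fin n) λ y → C y ≡ true × adj G x y ≡ true
    neighbour conn = search (conn c x) Cc
      where
      c = proj₁ (proj₁ (proj₂ ic))
      Cc = proj₂ (proj₁ (proj₂ ic))
      search : ∀ {u} → Reach G u x → C u ≡ true → Σ (Fin n) λ y → C y ≡ true × adj G x y ≡ true
      search here Cu = ⊥-elim (avoids-x Cu refl)
      search {u} (step {w = w} a r) Cu with toSum (w ≟ x)
      ... | inj₁ refl = u , Cu , adj-sym-true a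
      ... | inj₂ w≢x = search r (closed a (avoids-x Cu) w≢x Cu)

  same-component : ∀ {k H} → AreComponentsOfDelete G x k H →
    ∀ {i j v} → H i v ≡ true → H j v ≡ true → i ≡ j
  same-component {H = H} (ic , distinct , _) {i} {j} {v} Hiv Hjv = distinct i j same-vertices
    where
    same-vertices : ∀ w → H i w ≡ H j w
    same-vertices w with toSum (w ≟ x)
    ... | inj₁ refl = trans (proj₁ (ic i)) (sym (proj₁ (ic j)))
    ... | inj₂ w≢x = ⇔→≡ (mk⇔
      (λ Hiw → proj₂ (proj₂ (proj₂ (ic j)) v w Hjv w≢x) (proj₁ (proj₂ (proj₂ (ic i)) v w Hiv w≢x) Hiw))
      (λ Hjw → proj₂ (proj₂ (proj₂ (ic i)) v w Hiv w≢x) (proj₁ (proj₂ (proj₂ (ic j)) v w Hjv w≢x) Hjw)))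

  another-component : ∀ {k H} → IsCutVertex G x → AreComponentsOfDelete G x k H →
    ∀ i₀ → Σ (Fin k) λ i → i ≢ i₀
  another-component {H = H} (u₀ , v₀ , u₀≢x , v₀≢x , unreachable) comps@(ic , _ , cover) i₀
    with cover u₀ u₀≢x | cover v₀ v₀≢x
  ... | i₁ , Hu₀ | i₂ , Hv₀ with toSum (i₁ ≟ i₀)
  ... | inj₂ i₁≢i₀ = i₁ , i₁≢i₀
  ... | inj₁ refl = i₂ , λ { refl → unreachable (proj₁ (proj₂ (proj₂ (ic i₁)) u₀ v₀ Hu₀ v₀≢x) Hv₀) }

missed-value : ∀ {j k} (α : Fin j → Fin k) → j < k → Σ (Fin k) λ i → ∀ t → α t ≢ i
missed-value {j} {k} α j<k with any? (λ i → all? (λ t → ¬? (α t ≟ i)))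
... | yes found = found
... | no none = ⊥-elim (ℕ.<⇒≱ j<k (injective⇒≤ preimage-injective))
  where
  preimage : ∀ i → Σ (Fin j) λ t → α t ≡ i
  preimage i with any? (λ t → α t ≟ i)
  ... | yes hit = hit
  ... | no miss = ⊥-elim (none (i , λ t αt≡i → miss (t , αt≡i)))
  preimage-injective : Injective _≡_ _≡_ (proj₁ ∘ preimage)
  preimage-injective {i} {i′} eq = trans (sym (proj₂ (preimage i))) (trans (cong α eq) (proj₂ (preimage i′)))

module _ {n k j} (H : Fin k → VSet n) (α : Fin j → Fin k) where

  union⁻ : ∀ {v} → UnionOf H α v ≡ true → Σ (Fin j) λ t → H (α t) v ≡ true
  union⁻ {v} e with satisfied (any⁻ (λ t → H (α t) v) (allFin j) (Equivalence.from T-≡ e))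
  ... | t , hit = t , Equivalence.to T-≡ hit

  union⁺ : ∀ {v} t → H (α t) v ≡ true → UnionOf H α v ≡ true
  union⁺ {v} t hit = Equivalence.to T-≡ (any⁺ (λ t → H (α t) v) (lose (∈-allFin t) (Equivalence.from T-≡ hit)))

  outside-union : ∀ {v} → (∀ t → H (α t) v ≢ true) → not (UnionOf H α v) ≡ true
  outside-union {v} miss with UnionOf H α v in e
  ... | false = refl
  ... | true = ⊥-elim (let (t , hit) = union⁻ e in miss t hit)

module CutVertexMatchings {n} (G : Graph n) (side : VSet n) (conn : Connected G) (wed : WellEdgeDominated G)
                          (bip : IsBipartition G side) (A≤B : ∣ side ∣V ≤ ∣ (λ v → not (side v)) ∣V)
                          (x : Fin n) {k} {H : Fin k → VSet n} (comps : AreComponentsOfDelete G x k H) where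
  open Matching G
  open WellEdgeDominatedMatchings G wed
  open BipartiteWellEdgeDominated G wed side bip
  open CutVertex G x

  private
    saturates-A : ∀ {M} → IsMaximalMatching G M → ∀ {a} → side a ≡ true → Saturates M a
    saturates-A = maximal-saturates-A conn A≤B

    ic : ∀ i → IsComponentOfDelete G x (H i)
    ic = proj₁ comps

  x∈A : side x ≡ true → (i : Fin k) → Σ (EdgeSet n) λ M →
    IsMaximalMatching (Induced G (λ v → H i v ∨ (v == x))) M ×
    (∀ v → (H i v ∨ (v == x)) ≡ true → side v ≡ side x → Saturates M v)
  x∈A sx i = restrict M S , restrict-maximal G S mm M-closed ,
    λ v Sv sv≡sx → restrict-saturates G {M} {S} M-closed Sv (saturates-A mm (trans sv≡sx sx))
    where
    open Component (ic i)
    y = proj₁ (neighbour conn)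
    Hy = proj₁ (proj₂ (neighbour conn))
    axy = proj₂ (proj₂ (neighbour conn))
    S : VSet n
    S v = H i v ∨ (v == x)
    M = through y
    mm = through-maximal axy
    S-closed : ClosedInDelete S
    S-closed {u} a u≢x w≢x Su with ∨-true⁻ {H i u} Su
    ... | inj₁ Hu = ∨-trueˡ (closed a u≢x w≢x Hu)
    ... | inj₂ u==x = ⊥-elim (u≢x (==⇒≡ u==x))
    M-closed : Closed M S
    M-closed = matching-closed (proj₁ mm) S-closed λ e →
      subst (λ z → S z ≡ S x) (sym (through-mate axy e)) (trans (∨-trueˡ Hy) (sym (∨-trueʳ {H i x} (==-refl x))))

  module x∈B (cut : IsCutVertex G x) (sx : side x ≡ false) {j} (α : Fin j → Fin k) (j<k : j < k) where

    S : VSet n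
    S v = not (UnionOf H α v)

    private
      i₀ = proj₁ (missed-value α j<k)
      i₀-missed = proj₂ (missed-value α j<k)
      i′ = proj₁ (another-component cut comps i₀)
      i′≢i₀ = proj₂ (another-component cut comps i₀)
      module C₀ = Component (ic i₀)
      module C′ = Component (ic i′)

      C : VSet n
      C = H i₀
      y = proj₁ (C₀.neighbour conn)
      Cy = proj₁ (proj₂ (C₀.neighbour conn))
      axy = proj₂ (proj₂ (C₀.neighbour conn))
      y′ = proj₁ (C′.neighbour conn)
      H′y′ = proj₁ (proj₂ (C′.neighbour conn))
      axy′ = proj₂ (proj₂ (C′.neighbour conn))

      R : VSet n
      R v = not (C v) ∧ not (v == x)

      M = through y
      mm = through-maximal axy
      M′ = through y′
      mm′ = through-maximal axy′

      M₂ : EdgeSet n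
      M₂ = restrict M′ C ∪E restrict M R

      C∩R : ∀ {v} → C v ≡ true → R v ≡ false
      C∩R Cv rewrite Cv = refl

      Rx : R x ≡ false
      Rx rewrite ==-refl x = ∧-zeroʳ (not (C x))

      m₂ : IsMatching G M₂
      m₂ = spliced-matching G (proj₁ mm′) (proj₁ mm) C∩R

      M′-closed-on-C : Closed M′ C
      M′-closed-on-C = matching-closed (proj₁ mm′) C₀.closed λ e →
        subst (λ z → C z ≡ C x) (sym (through-mate axy′ e))
              (trans (≢true⇒≡false (λ Cy′ → i′≢i₀ (same-component comps H′y′ Cy′)))
                     (sym (proj₁ (ic i₀))))

      R-closed : ClosedInDelete R
      R-closed a u≢x w≢x Ru = ∧-true
        (cong not (≢true⇒≡false λ Cw →
          true≢false (C₀.closed (adj-sym-true a) w≢x u≢x Cw) (not-true⁻ (∧-trueˡ Ru))))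
        (cong not (==-≢ w≢x))

      M-closed-on-R : Closed M R
      M-closed-on-R = matching-closed (proj₁ mm) R-closed λ e →
        subst (λ z → R z ≡ R x) (sym (through-mate axy e)) (trans (C∩R Cy) (sym Rx))

      M₂-saturates-A : ∀ {a} → side a ≡ true → Saturates M₂ a
      M₂-saturates-A {a} sa = by-C (C a) refl
        where
        by-C : ∀ b → C a ≡ b → Saturates M₂ a
        by-C true Ca = sat-mono {restrict M′ C} {M₂} (λ u v → ∨-trueˡ)
          (restrict-saturates G {M′} {C} M′-closed-on-C Ca (saturates-A mm′ sa))
        by-C false Ca = sat-mono {restrict M R} {M₂} (λ u v → ∨-trueʳ {restrict M′ C u v})
          (restrict-saturates G {M} {R} M-closed-on-R (∧-true (cong not Ca) (cong not (==-≢ (different-sides sa sx))))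
            (saturates-A mm sa))

      M₂-frees-x : Free M₂ x
      M₂-frees-x (w , e) with ∨-true⁻ {restrict M′ C x w} e
      ... | inj₁ e′ = true≢false (proj₁ (restrict⁻ M′ C e′)) (proj₁ (ic i₀))
      ... | inj₂ e′ = true≢false (proj₁ (restrict⁻ M R e′)) Rx

      S-closed : ClosedInDelete S
      S-closed {u} a u≢x w≢x Su = outside-union H α λ t Hw →
        true≢false (union⁺ H α t (Component.closed (ic (α t)) (adj-sym-true a) w≢x u≢x Hw)) (not-true⁻ Su)

      Sx : S x ≡ true
      Sx = outside-union H α λ t hit → true≢false hit (proj₁ (ic (α t)))

      M-closed-on-S : Closed M S
      M-closed-on-S = matching-closed (proj₁ mm) S-closed λ e →
        subst (λ z → S z ≡ S x) (sym (through-mate axy e))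
              (trans (outside-union H α λ t hit → i₀-missed t (same-component comps hit Cy)) (sym Sx))

      M₂-closed-on-S : Closed M₂ S
      M₂-closed-on-S = matching-closed m₂ S-closed λ {w} e → ⊥-elim (M₂-frees-x (w , e))

      off-S-in-R : ∀ {u} → not (S u) ≡ true → C u ≡ false × R u ≡ true
      off-S-in-R {u} notSu with union⁻ H α (not-false⁻ (not-true⁻ notSu))
      ... | t , hit = Cu , ∧-true (cong not Cu) (cong not (==-≢ (Component.avoids-x (ic (α t)) hit)))
        where
        Cu : C u ≡ false
        Cu = ≢true⇒≡false λ Cu → i₀-missed t (same-component comps hit Cu)

      agree-off-S : ∀ {u v} → not (S u) ≡ true → not (S v) ≡ true → M₂ u v ≡ M u v
      agree-off-S {u} {v} notSu notSv
        with off-S-in-R notSu | off-S-in-R notSv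
      ... | Cu , Ru | _ , Rv rewrite Cu | Ru | Rv = refl

      mm₂ : IsMaximalMatching G M₂
      mm₂ = saturating-A⇒maximal m₂ M₂-saturates-A

      same-size : ∣ restrict M S ∣E ≡ ∣ restrict M₂ S ∣E
      same-size = ℕ.+-cancelʳ-≡ ∣ restrict M₂ (not ∘ S) ∣E _ _ (begin
        ∣ restrict M S ∣E + ∣ restrict M₂ (not ∘ S) ∣E
          ≡⟨ cong (∣ restrict M S ∣E +_) (∣∣E-cong (restrict-cong (not ∘ S) agree-off-S)) ⟩
        ∣ restrict M S ∣E + ∣ restrict M (not ∘ S) ∣E
          ≡⟨ ∣restrict∣-split G S (proj₁ mm) M-closed-on-S ⟨
        ∣ M ∣E
          ≡⟨ maximal-same-size mm mm₂ ⟩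
        ∣ M₂ ∣E
          ≡⟨ ∣restrict∣-split G S m₂ M₂-closed-on-S ⟩
        ∣ restrict M₂ S ∣E + ∣ restrict M₂ (not ∘ S) ∣E
          ∎)
        where open ≡-Reasoning

    matchings : Σ (EdgeSet n) λ M₁ → Σ (EdgeSet n) λ M₂ →
      IsMaximalMatching (Induced G S) M₁ × IsMaximalMatching (Induced G S) M₂ ×
      ∣ M₁ ∣E ≡ ∣ M₂ ∣E × Saturates M₁ x × ¬ Saturates M₂ x
    matchings = restrict M S , restrict M₂ S ,
      restrict-maximal G S mm M-closed-on-S ,
      restrict-maximal G S mm₂ M₂-closed-on-S ,
      same-size ,
      restrict-saturates G {M} {S} M-closed-on-S Sx (y , through-xy axy) ,
      free-mono (restrict-⊆ M₂ S) M₂-frees-x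

lemma6 : ∀ {n} (G : Graph n) (side : VSet n) →
    Connected G → WellEdgeDominated G →
    IsBipartition G side → ∣ side ∣V ≤ ∣ (λ v → not (side v)) ∣V →
    (x : Fin n) → IsCutVertex G x →
    (k : ℕ) (H : Fin k → VSet n) → AreComponentsOfDelete G x k H →
    (side x ≡ true →
      (i : Fin k) → Σ (EdgeSet n) λ M →
        IsMaximalMatching (Induced G (λ v → H i v ∨ (v == x))) M ×
        (∀ v → (H i v ∨ (v == x)) ≡ true → side v ≡ side x → Saturates M v))
    ×
    (side x ≡ false →
      (j : ℕ) (α : Fin j → Fin k) → Injective _≡_ _≡_ α → j < k →
      Σ (EdgeSet n) λ M₁ → Σ (EdgeSet n) λ M₂ →
        IsMaximalMatching (Induced G (λ v → not (UnionOf H α v))) M₁ ×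
        IsMaximalMatching (Induced G (λ v → not (UnionOf H α v))) M₂ ×
        ∣ M₁ ∣E ≡ ∣ M₂ ∣E ×
        Saturates M₁ x × ¬ Saturates M₂ x)
lemma6 G side conn wed bip A≤B x cut k H comps =
  x∈A , λ sx j α _ j<k → x∈B.matchings cut sx α j<k
  where open CutVertexMatchings G side conn wed bip A≤B x comps
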